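{- Let $(L,\vee,\wedge,\odot,\rightarrow,0,1)$ be a residuated lattice with order $\preceq$. For all $x,y,z\in L$, $$x^{\ast}\boxplus(y\boxplus z)=1 \quad\text{if and only if}\quad x\preceq y\boxplus z.$$
   Context: A residuated lattice is an algebra $(L,\vee,\wedge,\odot,\rightarrow,0,1)$ such that $(L,\vee,\wedge,0,1)$ is a bounded lattice (with lattice order $\preceq$), $(L,\odot,1)$ is a commutative monoid, and $x\odot z\preceq y$ iff $x\preceq z\rightarrow y$ for all $x,y,z\in L$. Notation: $x^{\ast}=x\rightarrow 0$, $x^{\ast\ast}=(x^\ast)^\ast$, and $x\boxplus y=x^{\ast}\rightarrow y^{\ast\ast}$. -}

module Defs where

open import Level using (Level; suc; _⊔_)
open import Relation.Binary.PropositionalEquality using (_≡_)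
open import Algebra.Lattice.Structures using (IsLattice)
open import Algebra.Structures using (IsCommutativeMonoid)
open import Data.Product using (_×_)

record ResiduatedLattice (c : Level) : Set (suc c) where
  infixr 5 _⇒_
  infixr 6 _∨_
  infixr 7 _∧_
  infixr 7 _⊙_
  infix 4 _≼_
  field
    Carrier : Set c
    _∨_ _∧_ _⊙_ _⇒_ : Carrier → Carrier → Carrier
    𝟘 𝟙 : Carrier
    isLattice : IsLattice _≡_ _∨_ _∧_
    isCommutativeMonoid : IsCommutativeMonoid _≡_ _⊙_ 𝟙

  _≼_ : Carrier → Carrier → Set c
  x ≼ y = x ∧ y ≡ x

  field
    bottom : ∀ x → 𝟘 ≼ x
    top : ∀ x → x ≼ 𝟙
    residuation-⇒ : ∀ x y z → x ⊙ z ≼ y → x ≼ z ⇒ y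
    residuation-⇐ : ∀ x y z → x ≼ z ⇒ y → x ⊙ z ≼ y

  _* : Carrier → Carrier
  x * = x ⇒ 𝟘

  _⊞_ : Carrier → Carrier → Carrier
  x ⊞ y = (x *) ⇒ ((y *) *)

-- Every element of the form a ⇒ b* is fixed by double negation, and y ⊞ z = y* ⇒ (z*)* is of
-- that form.  For such a w, x* ⊞ w = x** ⇒ w** = x** ⇒ w, which is 𝟙 exactly when x** ≼ w;
-- and since x ≼ x** and w = w**, this holds exactly when x ≼ w.
module Submission where

open import Defs
open import Level using (Level)
open import Relation.Binary.PropositionalEquality
  using (_≡_; refl; sym; trans; cong; subst; isEquivalence)
open import Relation.Binary.Bundles using (Poset)
open import Data.Product using (_×_; _,_)
open import Algebra.Lattice.Bundles using (Lattice)
open import Algebra.Structures using (IsCommutativeMonoid)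
import Algebra.Lattice.Properties.Lattice as LatticeProperties
import Relation.Binary.Reasoning.PartialOrder as PartialOrderReasoning

module ResiduatedLatticeProperties {c : Level} (L : ResiduatedLattice c) where
  open ResiduatedLattice L
  open IsCommutativeMonoid isCommutativeMonoid using (comm; assoc; identityˡ)

  lattice : Lattice c c
  lattice = record { isLattice = isLattice }

  -- The library's natural order is x ≡ x ∧ y, the converse equation of x ≼ y.
  open Poset (LatticeProperties.poset lattice) using (_≤_)
    renaming (refl to ≤-refl; trans to ≤-trans; antisym to ≤-antisym)

  ≼-refl : ∀ {a} → a ≼ a
  ≼-refl = sym ≤-refl

  ≼-reflexive : ∀ {a b} → a ≡ b → a ≼ b
  ≼-reflexive refl = ≼-refl

  ≼-trans : ∀ {a b d} → a ≼ b → b ≼ d → a ≼ d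
  ≼-trans p q = sym (≤-trans (sym p) (sym q))

  ≼-antisym : ∀ {a b} → a ≼ b → b ≼ a → a ≡ b
  ≼-antisym p q = ≤-antisym (sym p) (sym q)

  ≼-poset : Poset c c c
  ≼-poset = record
    { _≈_ = _≡_
    ; _≤_ = _≼_
    ; isPartialOrder = record
      { isPreorder = record
        { isEquivalence = isEquivalence
        ; reflexive = ≼-reflexive
        ; trans = ≼-trans
        }
      ; antisym = ≼-antisym
      }
    }

  open PartialOrderReasoning ≼-poset

  ⊙-residuum-≼ : ∀ a b → (a ⇒ b) ⊙ a ≼ b
  ⊙-residuum-≼ a b = residuation-⇐ (a ⇒ b) b a ≼-refl

  ⊙-monoˡ-≼ : ∀ {a b} d → a ≼ b → a ⊙ d ≼ b ⊙ d
  ⊙-monoˡ-≼ {a} {b} d a≼b =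
    residuation-⇐ a (b ⊙ d) d (≼-trans a≼b (residuation-⇒ b (b ⊙ d) d ≼-refl))

  ⊙-monoʳ-≼ : ∀ {a b} d → a ≼ b → d ⊙ a ≼ d ⊙ b
  ⊙-monoʳ-≼ {a} {b} d a≼b = begin
    d ⊙ a  ≡⟨ comm d a ⟩
    a ⊙ d  ≤⟨ ⊙-monoˡ-≼ d a≼b ⟩
    b ⊙ d  ≡⟨ comm b d ⟩
    d ⊙ b  ∎

  residuum≡𝟙⇒≼ : ∀ {a b} → a ⇒ b ≡ 𝟙 → a ≼ b
  residuum≡𝟙⇒≼ {a} {b} a⇒b≡𝟙 = begin
    a            ≡⟨ identityˡ a ⟨
    𝟙 ⊙ a        ≡⟨ cong (_⊙ a) a⇒b≡𝟙 ⟨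
    (a ⇒ b) ⊙ a  ≤⟨ ⊙-residuum-≼ a b ⟩
    b            ∎

  ≼⇒residuum≡𝟙 : ∀ {a b} → a ≼ b → a ⇒ b ≡ 𝟙
  ≼⇒residuum≡𝟙 {a} {b} a≼b = ≼-antisym (top (a ⇒ b))
    (residuation-⇒ 𝟙 b a (≼-trans (≼-reflexive (identityˡ a)) a≼b))

  ≼-** : ∀ a → a ≼ (a *) *
  ≼-** a = residuation-⇒ a 𝟘 (a *) (≼-trans (≼-reflexive (comm a (a *))) (⊙-residuum-≼ a 𝟘))

  *-antitone : ∀ {a b} → a ≼ b → b * ≼ a *
  *-antitone {a} {b} a≼b = residuation-⇒ (b *) 𝟘 a (begin
    b * ⊙ a  ≤⟨ ⊙-monoʳ-≼ (b *) a≼b ⟩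
    b * ⊙ b  ≤⟨ ⊙-residuum-≼ b 𝟘 ⟩
    𝟘        ∎)

  Regular : Carrier → Set c
  Regular a = (a *) * ≡ a

  *-regular : ∀ a → Regular (a *)
  *-regular a = ≼-antisym (*-antitone (≼-** a)) (≼-** (a *))

  residuum-*≡⊙-* : ∀ a b → a ⇒ (b *) ≡ (a ⊙ b) *
  residuum-*≡⊙-* a b = ≼-antisym
    (residuation-⇒ (a ⇒ b *) 𝟘 (a ⊙ b) (begin
      (a ⇒ b *) ⊙ (a ⊙ b)  ≡⟨ assoc (a ⇒ b *) a b ⟨
      ((a ⇒ b *) ⊙ a) ⊙ b  ≤⟨ ⊙-monoˡ-≼ b (⊙-residuum-≼ a (b *)) ⟩
      b * ⊙ b              ≤⟨ ⊙-residuum-≼ b 𝟘 ⟩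
      𝟘                    ∎))
    (residuation-⇒ ((a ⊙ b) *) (b *) a (residuation-⇒ ((a ⊙ b) * ⊙ a) 𝟘 b (begin
      ((a ⊙ b) * ⊙ a) ⊙ b  ≡⟨ assoc ((a ⊙ b) *) a b ⟩
      (a ⊙ b) * ⊙ (a ⊙ b)  ≤⟨ ⊙-residuum-≼ (a ⊙ b) 𝟘 ⟩
      𝟘                    ∎)))

  residuum-*-regular : ∀ a b → Regular (a ⇒ (b *))
  residuum-*-regular a b =
    subst Regular (sym (residuum-*≡⊙-* a b)) (*-regular (a ⊙ b))

  ⊞-regular : ∀ x y → Regular (x ⊞ y)
  ⊞-regular x y = residuum-*-regular (x *) (y *)

  **-≼-regular : ∀ {x w} → Regular w → x ≼ w → (x *) * ≼ w
  **-≼-regular {x} {w} w** x≼w = begin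
    (x *) *  ≤⟨ *-antitone (*-antitone x≼w) ⟩
    (w *) *  ≡⟨ w** ⟩
    w        ∎

  *-⊞-regular≡𝟙⇔≼ : ∀ x {w} → Regular w → ((x *) ⊞ w ≡ 𝟙 → x ≼ w) × (x ≼ w → (x *) ⊞ w ≡ 𝟙)
  *-⊞-regular≡𝟙⇔≼ x {w} w** = ⊞≡𝟙⇒≼ , ≼⇒⊞≡𝟙
    where
    x*⊞w≡x**⇒w : (x *) ⊞ w ≡ (x *) * ⇒ w
    x*⊞w≡x**⇒w = cong ((x *) * ⇒_) w**

    ⊞≡𝟙⇒≼ : (x *) ⊞ w ≡ 𝟙 → x ≼ w
    ⊞≡𝟙⇒≼ e = ≼-trans (≼-** x) (residuum≡𝟙⇒≼ (trans (sym x*⊞w≡x**⇒w) e))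

    ≼⇒⊞≡𝟙 : x ≼ w → (x *) ⊞ w ≡ 𝟙
    ≼⇒⊞≡𝟙 x≼w = trans x*⊞w≡x**⇒w (≼⇒residuum≡𝟙 (**-≼-regular w** x≼w))

lemma2 : {c : Level} (L : ResiduatedLattice c) → let open ResiduatedLattice L in
    ∀ x y z → ((((x *) ⊞ (y ⊞ z)) ≡ 𝟙 → x ≼ (y ⊞ z)) × (x ≼ (y ⊞ z) → ((x *) ⊞ (y ⊞ z)) ≡ 𝟙))
lemma2 L x y z = *-⊞-regular≡𝟙⇔≼ x (⊞-regular y z)
  where open ResiduatedLatticeProperties L
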